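{- Let $\mathsf{K}$ be a quasivariety, $\mathbf{B}\in\mathsf{K}$, and $\mathbf{A}\le\mathbf{B}$ full in $\mathsf{K}$. If $\theta,\phi\in\mathsf{Con}_\mathsf{K}(\mathbf{B})$ satisfy $\theta\ne\phi$ and $\theta\cap(A\times A)=\phi\cap(A\times A)$, then $\theta\cap\phi=\mathrm{id}_B$.
   Context: A quasivariety is a class of similar algebras closed under isomorphic copies, subalgebras, direct products and ultraproducts. For $\mathbf{B}\in\mathsf{K}$, a $\mathsf{K}$-congruence is a congruence $\theta$ with $\mathbf{B}/\theta\in\mathsf{K}$; $\mathsf{Con}_\mathsf{K}(\mathbf{B})$ is the set of these; $\mathrm{id}_B$ is the identity relation. A subalgebra $\mathbf{A}\le\mathbf{B}$ is full in $\mathsf{K}$ if it is proper, $B$ is generated by $A\cup\{b\}$ for some $b\in B$, and for every $\theta\in\mathsf{Con}_\mathsf{K}(\mathbf{B})$ with $\theta\ne\mathrm{id}_B$ and every $b\in B$ there is $a\in A$ with $\langle a,b\rangle\in\theta$. -}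

module Defs where

open import Level using (0ℓ)
open import Data.Nat using (ℕ; zero; suc)
open import Data.Fin using (Fin; zero; suc)
open import Data.Product using (Σ; _×_; _,_; proj₁; proj₂)
open import Data.Sum using (_⊎_)
open import Data.Unit using (⊤)
open import Data.Empty using (⊥)
open import Function using (_∘_)
open import Relation.Nullary using (¬_)
open import Relation.Binary using (IsEquivalence)

record Signature : Set₁ where
  field
    Op    : Set
    arity : Op → ℕ
open Signature public

-- Algebras over a setoid carrier (equality _≈_ plays the role of =).
record Algebra (S : Signature) : Set₁ where
  field
    Carrier : Set
    _≈_     : Carrier → Carrier → Set
    isEquiv : IsEquivalence _≈_
    op      : (f : Op S) → (Fin (arity S f) → Carrier) → Carrier
    op-cong : ∀ f {xs ys : Fin (arity S f) → Carrier} →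
              (∀ i → xs i ≈ ys i) → op f xs ≈ op f ys
open Algebra public

module _ {S : Signature} where

  BRel : Algebra S → Set₁
  BRel B = Carrier B → Carrier B → Set

  RelEq : {B : Algebra S} → BRel B → BRel B → Set
  RelEq {B} R Q = ∀ x y → (R x y → Q x y) × (Q x y → R x y)

  record _≅_ (A B : Algebra S) : Set where
    field
      h      : Carrier A → Carrier B
      h-cong : ∀ {x y} → _≈_ A x y → _≈_ B (h x) (h y)
      h-hom  : ∀ f (xs : Fin (arity S f) → Carrier A) →
               _≈_ B (h (op A f xs)) (op B f (h ∘ xs))
      h-inj  : ∀ {x y} → _≈_ B (h x) (h y) → _≈_ A x y
      h-surj : ∀ b → Σ (Carrier A) (λ a → _≈_ B (h a) b)

  record IsSubuniverse (B : Algebra S) (P : Carrier B → Set) : Set where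
    field
      resp-≈ : ∀ {x y} → _≈_ B x y → P x → P y
      closed : ∀ f (xs : Fin (arity S f) → Carrier B) →
               (∀ i → P (xs i)) → P (op B f xs)
  open IsSubuniverse public

  Sub : (B : Algebra S) (P : Carrier B → Set) → IsSubuniverse B P → Algebra S
  Sub B P s = record
    { Carrier = Σ (Carrier B) P
    ; _≈_     = λ x y → _≈_ B (proj₁ x) (proj₁ y)
    ; isEquiv = record { refl = IsEquivalence.refl (isEquiv B)
                       ; sym = IsEquivalence.sym (isEquiv B)
                       ; trans = IsEquivalence.trans (isEquiv B) }
    ; op      = λ f xs → op B f (proj₁ ∘ xs) , closed s f (proj₁ ∘ xs) (proj₂ ∘ xs)
    ; op-cong = λ f eq → op-cong B f eq
    }

  data Sg (B : Algebra S) (X : Carrier B → Set) : Carrier B → Set where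
    gen  : ∀ {x} → X x → Sg B X x
    app  : ∀ f (xs : Fin (arity S f) → Carrier B) →
           (∀ i → Sg B X (xs i)) → Sg B X (op B f xs)
    resp : ∀ {x y} → _≈_ B x y → Sg B X x → Sg B X y

  Π : (I : Set) → (I → Algebra S) → Algebra S
  Π I A = record
    { Carrier = (i : I) → Carrier (A i)
    ; _≈_     = λ x y → ∀ i → _≈_ (A i) (x i) (y i)
    ; isEquiv = record { refl = λ i → IsEquivalence.refl (isEquiv (A i))
                       ; sym = λ p i → IsEquivalence.sym (isEquiv (A i)) (p i)
                       ; trans = λ p q i → IsEquivalence.trans (isEquiv (A i)) (p i) (q i) }
    ; op      = λ f xs i → op (A i) f (λ k → xs k i)
    ; op-cong = λ f eq i → op-cong (A i) f (λ k → eq k i)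
    }

record Ultrafilter (I : Set) : Set₁ where
  field
    U        : (I → Set) → Set
    U-full   : U (λ _ → ⊤)
    U-proper : ¬ U (λ _ → ⊥)
    U-up     : ∀ {P Q} → U P → (∀ i → P i → Q i) → U Q
    U-meet   : ∀ {P Q} → U P → U Q → U (λ i → P i × Q i)
    U-ultra  : ∀ P → U P ⊎ U (λ i → ¬ P i)
open Ultrafilter public

meetFin : ∀ {I} (F : Ultrafilter I) n (P : Fin n → I → Set) →
          (∀ k → U F (P k)) → U F (λ i → ∀ k → P k i)
meetFin F zero P _ = U-up F (U-full F) (λ i _ ())
meetFin F (suc n) P u =
  U-up F (U-meet F (u zero) (meetFin F n (P ∘ suc) (u ∘ suc)))
    (λ { i (p , q) zero → p ; i (p , q) (suc k) → q k })

module _ {S : Signature} where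

  Ultra : (I : Set) → Ultrafilter I → (I → Algebra S) → Algebra S
  Ultra I F A = record
    { Carrier = (i : I) → Carrier (A i)
    ; _≈_     = λ x y → U F (λ i → _≈_ (A i) (x i) (y i))
    ; isEquiv = record
        { refl  = U-up F (U-full F) (λ i _ → IsEquivalence.refl (isEquiv (A i)))
        ; sym   = λ p → U-up F p (λ i → IsEquivalence.sym (isEquiv (A i)))
        ; trans = λ p q → U-up F (U-meet F p q)
                    (λ i pq → IsEquivalence.trans (isEquiv (A i)) (proj₁ pq) (proj₂ pq)) }
    ; op      = λ f xs i → op (A i) f (λ k → xs k i)
    ; op-cong = λ f {xs} {ys} eq →
        U-up F (meetFin F (arity S f) (λ k i → _≈_ (A i) (xs k i) (ys k i)) eq)
          (λ i e → op-cong (A i) f e)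
    }

  -- Congruences (on a setoid algebra they contain ≈) and quotients
  record IsCongruence (B : Algebra S) (θ : BRel B) : Set where
    field
      θ-equiv  : IsEquivalence θ
      ≈⊆θ      : ∀ {x y} → _≈_ B x y → θ x y
      θ-compat : ∀ f {xs ys : Fin (arity S f) → Carrier B} →
                 (∀ i → θ (xs i) (ys i)) → θ (op B f xs) (op B f ys)
  open IsCongruence public

  Quot : (B : Algebra S) (θ : BRel B) → IsCongruence B θ → Algebra S
  Quot B θ c = record
    { Carrier = Carrier B ; _≈_ = θ ; isEquiv = θ-equiv c
    ; op = op B ; op-cong = θ-compat c }

  record IsQuasivariety (K : Algebra S → Set₁) : Set₁ where
    field
      iso-closed   : ∀ {A B} → K A → A ≅ B → K B
      sub-closed   : ∀ {B} P (s : IsSubuniverse B P) → K B → K (Sub B P s)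
      prod-closed  : ∀ (I : Set) (A : I → Algebra S) → (∀ i → K (A i)) → K (Π I A)
      ultra-closed : ∀ (I : Set) (F : Ultrafilter I) (A : I → Algebra S) →
                     (∀ i → K (A i)) → K (Ultra I F A)

  IsKCongruence : (K : Algebra S → Set₁) (B : Algebra S) → BRel B → Set₁
  IsKCongruence K B θ = Σ (IsCongruence B θ) (λ c → K (Quot B θ c))

  record IsFull (K : Algebra S → Set₁) (B : Algebra S)
                (A : Carrier B → Set) : Set₁ where
    field
      proper    : Σ (Carrier B) (λ b → ¬ A b)
      generated : Σ (Carrier B) (λ b → ∀ c → Sg B (λ x → A x ⊎ _≈_ B x b) c)
      dense     : ∀ (θ : BRel B) → IsKCongruence K B θ →
                  ¬ RelEq {B = B} θ (_≈_ B) →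
                  ∀ b → Σ (Carrier B) (λ a → A a × θ a b)

  restrictTo : (B : Algebra S) → (Carrier B → Set) → BRel B → BRel B
  restrictTo B A θ x y = A x × A y × θ x y

  _∩_ : {B : Algebra S} → BRel B → BRel B → BRel B
  (θ ∩ φ) x y = θ x y × φ x y

{-# OPTIONS --safe #-}
module Submission where

open import Defs
open import Level using (0ℓ)
open import Axiom.ExcludedMiddle using (ExcludedMiddle)
open import Relation.Nullary using (¬_)
open import Relation.Nullary.Decidable.Core using (yes; no)
open import Relation.Binary using (IsEquivalence)
open import Data.Bool using (Bool; true; false)
open import Data.Product using (Σ; _×_; _,_; proj₁; proj₂; map₂; swap)
open import Data.Empty using (⊥-elim)
open import Function using (_∘_)

-- Since B/(θ ∩ φ) embeds into B/θ × B/φ, the meet of two K-congruences is a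
-- K-congruence. If θ ∩ φ were not the identity, fullness would make every
-- element of B congruent modulo θ ∩ φ to an element of A, and two congruences
-- agreeing on such a dense A agree everywhere, i.e. θ = φ. The excluded middle
-- turns this contrapositive into the statement.

module _ {S : Signature} {B : Algebra S} where

  ∩-isCongruence : ∀ {θ φ : BRel B} → IsCongruence B θ → IsCongruence B φ →
                   IsCongruence B (_∩_ {B = B} θ φ)
  ∩-isCongruence cθ cφ = record
    { θ-equiv  = record
      { refl  = Eθ.refl , Eφ.refl
      ; sym   = λ (t , f) → Eθ.sym t , Eφ.sym f
      ; trans = λ (t , f) (t′ , f′) → Eθ.trans t t′ , Eφ.trans f f′ }
    ; ≈⊆θ      = λ e → ≈⊆θ cθ e , ≈⊆θ cφ e
    ; θ-compat = λ f e → θ-compat cθ f (proj₁ ∘ e) , θ-compat cφ f (proj₂ ∘ e) }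
    where
    module Eθ = IsEquivalence (θ-equiv cθ)
    module Eφ = IsEquivalence (θ-equiv cφ)

  module QuotientPair {θ φ : BRel B} (cθ : IsCongruence B θ) (cφ : IsCongruence B φ) where

    private
      module Eθ = IsEquivalence (θ-equiv cθ)
      module Eφ = IsEquivalence (θ-equiv cφ)

    Quots : Bool → Algebra S
    Quots true  = Quot B θ cθ
    Quots false = Quot B φ cφ

    Diagonal : Carrier (Π Bool Quots) → Set
    Diagonal p = Σ (Carrier B) λ b → θ (p true) b × φ (p false) b

    diagonal-isSubuniverse : IsSubuniverse (Π Bool Quots) Diagonal
    diagonal-isSubuniverse = record
      { resp-≈ = λ e (b , t , f) → b , Eθ.trans (Eθ.sym (e true)) t , Eφ.trans (Eφ.sym (e false)) f
      ; closed = λ f _ d → op B f (proj₁ ∘ d)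
                         , θ-compat cθ f (proj₁ ∘ proj₂ ∘ d)
                         , θ-compat cφ f (proj₂ ∘ proj₂ ∘ d) }

    diagonal≅Quot-∩ : Sub (Π Bool Quots) Diagonal diagonal-isSubuniverse ≅
                      Quot B (_∩_ {B = B} θ φ) (∩-isCongruence cθ cφ)
    diagonal≅Quot-∩ = record
      { h      = proj₁ ∘ proj₂
      ; h-cong = λ { {_ , _ , t , f} {_ , _ , t′ , f′} e →
                       Eθ.trans (Eθ.sym t) (Eθ.trans (e true) t′)
                     , Eφ.trans (Eφ.sym f) (Eφ.trans (e false) f′) }
      ; h-hom  = λ _ _ → Eθ.refl , Eφ.refl
      ; h-inj  = λ { {_ , _ , t , f} {_ , _ , t′ , f′} (eθ , eφ) →
                     λ { true  → Eθ.trans t (Eθ.trans eθ (Eθ.sym t′))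
                       ; false → Eφ.trans f (Eφ.trans eφ (Eφ.sym f′)) } }
      ; h-surj = λ b → ((λ { true → b ; false → b }) , b , Eθ.refl , Eφ.refl) , Eθ.refl , Eφ.refl }

  ∩-isKCongruence : ∀ {K} → IsQuasivariety K → ∀ {θ φ : BRel B} →
                    IsKCongruence K B θ → IsKCongruence K B φ →
                    IsKCongruence K B (_∩_ {B = B} θ φ)
  ∩-isKCongruence {K} KQ (cθ , Kθ) (cφ , Kφ) =
    ∩-isCongruence cθ cφ ,
    iso-closed (sub-closed Diagonal diagonal-isSubuniverse (prod-closed Bool Quots K-Quots))
               diagonal≅Quot-∩
    where
    open IsQuasivariety KQ
    open QuotientPair cθ cφ
    K-Quots : ∀ i → K (Quots i)
    K-Quots true  = Kθ
    K-Quots false = Kφ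

  restriction-⊆⇒⊆ : ∀ {A : Carrier B → Set} {θ φ : BRel B} →
                    IsEquivalence θ → IsEquivalence φ →
                    (∀ b → Σ (Carrier B) λ a → A a × θ a b × φ a b) →
                    (∀ x y → restrictTo B A θ x y → restrictTo B A φ x y) →
                    ∀ {x y} → θ x y → φ x y
  restriction-⊆⇒⊆ {φ = φ} θ-eq φ-eq dense θ|A⊆φ|A {x} {y} x~y
    with dense x | dense y
  ... | a , Aa , a~θx , a~φx | a′ , Aa′ , a′~θy , a′~φy =
    Eφ.trans (Eφ.sym a~φx) (Eφ.trans a~φa′ a′~φy)
    where
    module Eθ = IsEquivalence θ-eq
    module Eφ = IsEquivalence φ-eq
    a~φa′ : φ a a′
    a~φa′ = proj₂ (proj₂ (θ|A⊆φ|A a a′ (Aa , Aa′ , Eθ.trans a~θx (Eθ.trans x~y (Eθ.sym a′~θy)))))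

lemma3p9 : ExcludedMiddle 0ℓ →
    {S : Signature} (K : Algebra S → Set₁) → IsQuasivariety K →
    (B : Algebra S) → K B →
    (A : Carrier B → Set) → IsSubuniverse B A → IsFull K B A →
    (θ φ : BRel B) → IsKCongruence K B θ → IsKCongruence K B φ →
    ¬ RelEq {B = B} θ φ →
    RelEq {B = B} (restrictTo B A θ) (restrictTo B A φ) →
    RelEq {B = B} (_∩_ {B = B} θ φ) (_≈_ B)
lemma3p9 lem K KQ B _ A _ full θ φ Kθ@(cθ , _) Kφ@(cφ , _) θ≉φ θ|A≈φ|A with lem
... | yes ∩≈id = ∩≈id
... | no ∩≉id  = ⊥-elim (θ≉φ λ x y → θ⊆φ , φ⊆θ)
  where
  dense : ∀ b → Σ (Carrier B) λ a → A a × θ a b × φ a b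
  dense = IsFull.dense full (_∩_ {B = B} θ φ) (∩-isKCongruence KQ Kθ Kφ) ∩≉id
  θ⊆φ : ∀ {x y} → θ x y → φ x y
  θ⊆φ = restriction-⊆⇒⊆ {B = B} (θ-equiv cθ) (θ-equiv cφ) dense (λ x y → proj₁ (θ|A≈φ|A x y))
  φ⊆θ : ∀ {x y} → φ x y → θ x y
  φ⊆θ = restriction-⊆⇒⊆ {B = B} (θ-equiv cφ) (θ-equiv cθ) (map₂ (map₂ swap) ∘ dense)
                         (λ x y → proj₂ (θ|A≈φ|A x y))
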